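{- Let $S$ be a wildcard string of length $n$ and let $u\ge 1$ be an integer block size. Run the following algorithm. Phase 1: initialize $\tilde R[c]=0$ for all centers $c$; for each $i=1,\dots,\lceil n/u\rceil$, let $p_i=\min\{iu,n\}$, and for every center $c$ such that $S[1..p_i]$ has a palindromic prefix centered at $c$ or a palindromic suffix centered at $c$, set $\tilde R[c]\gets\max\{\tilde R[c],\,\min(c-1,\,p_i-c)\}$. Phase 2: for every center $c$, set $R[c]\gets \tilde R[c]+e_c$, where $e_c$ is the number of consecutive successful character comparisons $S[c-\tilde R[c]-t]\approx S[c+\tilde R[c]+t]$ for $t=1,2,\dots$ (stopping at the first mismatch or when an index leaves $[1..n]$). Then upon termination, $R[c]=r_c$ for every center $c$, where $r_c$ is the radius of the maximal subpalindrome of $S$ centered at $c$.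
   Context: A wildcard $\phi$ matches every character; characters $x,y$ match ($x\approx y$) if $x=y$ or one of them is $\phi$; strings of equal length match if they match position-wise. The reverse of $A=A[1]\cdots A[m]$ is $A[m]\cdots A[1]$, and $A$ is a palindrome if it matches its reverse. Only odd-length palindromes are considered: centers are integer positions $c\in\{1,\dots,n\}$, and $[c-r..c+r]$ (with $1\le c-r$, $c+r\le n$) is a subpalindrome centered at $c$ of radius $r$ if $S[c-r..c+r]$ is a palindrome; $r_c$ is the largest such $r$ (the maximal subpalindrome at $c$). A string $F=S[\ell..q]$ has a palindromic prefix centered at $c$ if $2c-\ell\le q$ and $S[\ell..2c-\ell]$ is a palindrome, and a palindromic suffix centered at $c$ if $2c-q\ge \ell$ and $S[2c-q..q]$ is a palindrome. (These are exactly the alignments reported by the matching self-convolution of $F$ with its reverse.) -}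

module Defs where

open import Data.Nat using (ℕ; zero; suc; _+_; _*_; _∸_; _≤_; _<_; _⊔_; _⊓_; NonZero; _≤?_; _<?_; >-nonZero)
open import Data.Nat.DivMod using (_/_)
open import Data.Fin using (Fin; toℕ)
open import Data.Fin.Properties using (all?)
open import Data.Vec using (Vec; lookup)
open import Data.Maybe using (Maybe; just; nothing)
open import Data.Product using (_×_; _,_)
open import Data.Sum using (_⊎_)
open import Data.Unit using (⊤; tt)
open import Relation.Binary.PropositionalEquality using (_≡_)
open import Relation.Binary.Definitions using (DecidableEquality)
open import Relation.Nullary using (Dec; yes; no; ¬_)
open import Relation.Nullary.Decidable using (_×-dec_; _⊎-dec_)

-- Wildcard characters over an alphabet A: nothing = the wildcard φ.

WChar : Set → Set
WChar A = Maybe A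

_≈c_ : {A : Set} → WChar A → WChar A → Set
nothing ≈c _       = ⊤
just _  ≈c nothing = ⊤
just a  ≈c just b  = a ≡ b

≈c-dec : {A : Set} → DecidableEquality A → (x y : WChar A) → Dec (x ≈c y)
≈c-dec _≟_ nothing  _        = yes tt
≈c-dec _≟_ (just _) nothing  = yes tt
≈c-dec _≟_ (just a) (just b) = a ≟ b

-- S at i  is the 1-based character S[i] for 1 ≤ i ≤ n.
-- (Out-of-range positions return φ; every use below is guarded so that
--  only in-range positions are ever inspected.)

_at_ : {A : Set} {n : ℕ} → Vec (WChar A) n → ℕ → WChar A
_at_ {n = n} S zero = nothing
_at_ {n = n} S (suc k) with suc k ≤? n
... | yes p = lookup S (Data.Fin.fromℕ< p)
... | no _  = nothing

Pal : {A : Set} {n : ℕ} → Vec (WChar A) n → ℕ → ℕ → Set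
Pal S l q = (j : Fin (suc q ∸ l)) → (S at (l + toℕ j)) ≈c (S at (q ∸ toℕ j))

Pal-dec : {A : Set} → DecidableEquality A → {n : ℕ} (S : Vec (WChar A) n) (l q : ℕ) → Dec (Pal S l q)
Pal-dec eq S l q = all? (λ j → ≈c-dec eq (S at (l + toℕ j)) (S at (q ∸ toℕ j)))

-- [c-r..c+r] is a subpalindrome centred at c of radius r
-- (1 ≤ c - r, i.e. r < c, and c + r ≤ n).
SubPal : {A : Set} {n : ℕ} → Vec (WChar A) n → ℕ → ℕ → Set
SubPal {n = n} S c r = (r < c) × (c + r ≤ n) × Pal S (c ∸ r) (c + r)

IsMaxRadius : {A : Set} {n : ℕ} → Vec (WChar A) n → ℕ → ℕ → Set
IsMaxRadius S c r = SubPal S c r × (∀ r' → SubPal S c r' → r' ≤ r)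

PalPrefix : {A : Set} {n : ℕ} → Vec (WChar A) n → ℕ → ℕ → Set
PalPrefix S p c = (1 ≤ c) × (c + c ∸ 1 ≤ p) × Pal S 1 (c + c ∸ 1)

-- F = S[1..p] has a palindromic suffix centred at c:
--   2c - p ≥ 1 and S[2c-p..p] is a palindrome  (with c ≤ p, so that the
--   range is a genuine (nonempty) substring of F).
PalSuffix : {A : Set} {n : ℕ} → Vec (WChar A) n → ℕ → ℕ → Set
PalSuffix S p c = (suc p ≤ c + c) × (c ≤ p) × Pal S (c + c ∸ p) p

PalPrefix-dec : {A : Set} → DecidableEquality A → {n : ℕ} (S : Vec (WChar A) n) (p c : ℕ) → Dec (PalPrefix S p c)
PalPrefix-dec eq S p c = (1 ≤? c) ×-dec ((c + c ∸ 1 ≤? p) ×-dec Pal-dec eq S 1 (c + c ∸ 1))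

PalSuffix-dec : {A : Set} → DecidableEquality A → {n : ℕ} (S : Vec (WChar A) n) (p c : ℕ) → Dec (PalSuffix S p c)
PalSuffix-dec eq S p c = (suc p ≤? c + c) ×-dec ((c ≤? p) ×-dec Pal-dec eq S (c + c ∸ p) p)

phase1-step : {A : Set} → DecidableEquality A → {n : ℕ} → Vec (WChar A) n → ℕ → (ℕ → ℕ) → (ℕ → ℕ)
phase1-step eq S p R c with PalPrefix-dec eq S p c ⊎-dec PalSuffix-dec eq S p c
... | yes _ = R c ⊔ ((c ∸ 1) ⊓ (p ∸ c))
... | no _  = R c

ceilDiv : ℕ → (u : ℕ) → 1 ≤ u → ℕ
ceilDiv n u h = _/_ (n + u ∸ 1) u {{>-nonZero h}}

phase1-upto : {A : Set} → DecidableEquality A → {n : ℕ} → Vec (WChar A) n → ℕ → ℕ → (ℕ → ℕ)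
phase1-upto eq S u zero    = λ _ → 0
phase1-upto eq {n} S u (suc k) = phase1-step eq S ((suc k * u) ⊓ n) (phase1-upto eq S u k)

phase1 : {A : Set} → DecidableEquality A → {n : ℕ} → Vec (WChar A) n → (u : ℕ) → 1 ≤ u → (ℕ → ℕ)
phase1 eq {n} S u h = phase1-upto eq S u (ceilDiv n u h)

-- Number of consecutive successful comparisons S[i-t] ≈ S[j+t], t = 1,2,…
-- stopping at the first mismatch or when an index leaves [1..n].
-- (The fuel argument is taken to be n, which bounds the number of steps.)
extendCount : {A : Set} → DecidableEquality A → {n : ℕ} → Vec (WChar A) n → ℕ → ℕ → ℕ → ℕ
extendCount eq S zero i j = 0
extendCount eq {n} S (suc f) i j with 2 ≤? i | suc j ≤? n
... | yes _ | yes _ with ≈c-dec eq (S at (i ∸ 1)) (S at (suc j))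
...   | yes _ = suc (extendCount eq S f (i ∸ 1) (suc j))
...   | no _  = 0
extendCount eq S (suc f) i j | _ | _ = 0

algorithm : {A : Set} → DecidableEquality A → {n : ℕ} → Vec (WChar A) n → (u : ℕ) → 1 ≤ u → (ℕ → ℕ)
algorithm eq {n} S u h c =
  phase1 eq S u h c + extendCount eq S n (c ∸ phase1 eq S u h c) (c + phase1 eq S u h c)

{-# OPTIONS --safe #-}
-- Phase 1 only ever records radii of genuine subpalindromes: a palindromic prefix
-- or suffix of S[1..p] centred at c is a subpalindrome of S centred at c, and
-- subpalindromes around a fixed centre are closed under shrinking the radius.
-- Hence R̃[c] ≤ r_c, whatever the block size. Phase 2 extends R̃[c] one matching
-- pair at a time, and the reason it stops (a mismatch, or an end of S) rules out
-- every larger radius; it never runs out of its n steps since r_c < c ≤ n.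
module Submission where

open import Defs
open import Data.Nat using (ℕ; zero; suc; _+_; _∸_; _≤_; _<_; _⊔_; z≤n; s≤s; s≤s⁻¹; _≤?_)
open import Data.Nat.Properties
open import Data.Fin using (toℕ; fromℕ<)
open import Data.Fin.Properties using (toℕ-fromℕ<; toℕ<n)
open import Data.Maybe using (just; nothing)
open import Data.Product using (_,_)
open import Data.Sum using (inj₁; inj₂)
open import Data.Unit using (tt)
open import Data.Vec using (Vec)
open import Function.Base using (id; _∘_)
open import Relation.Binary.Definitions using (DecidableEquality)
open import Relation.Binary.PropositionalEquality
open import Relation.Nullary using (yes; no; ¬_)
open import Relation.Nullary.Decidable using (_⊎-dec_)
open import Relation.Nullary.Negation using (contradiction)

≈c-refl : {A : Set} (x : WChar A) → x ≈c x
≈c-refl nothing  = tt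
≈c-refl (just _) = refl

≈c-sym : {A : Set} {x y : WChar A} → x ≈c y → y ≈c x
≈c-sym {x = nothing} {y = nothing} _ = tt
≈c-sym {x = nothing} {y = just _}  _ = tt
≈c-sym {x = just _}  {y = nothing} _ = tt
≈c-sym {x = just _}  {y = just _}  e = sym e

m<n∸o⇒o+m<n : ∀ {m} n o → m < n ∸ o → o + m < n
m<n∸o⇒o+m<n n       zero    lt = lt
m<n∸o⇒o+m<n zero    (suc o) ()
m<n∸o⇒o+m<n (suc n) (suc o) lt = s≤s (m<n∸o⇒o+m<n n o lt)

m∸n∸1≡m∸suc[n] : ∀ m n → m ∸ n ∸ 1 ≡ m ∸ suc n
m∸n∸1≡m∸suc[n] m n = trans (∸-+-assoc m n 1) (cong (m ∸_) (+-comm n 1))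

module _ {A : Set} {n : ℕ} (S : Vec (WChar A) n) where

  -- Pal S l q without Fin indexing: positions symmetric about the midpoint of [l..q] match.
  Mirrored : ℕ → ℕ → Set
  Mirrored l q = ∀ {i j} → l ≤ i → i ≤ q → i + j ≡ l + q → (S at i) ≈c (S at j)

  Pal⇒Mirrored : ∀ {l q} → Pal S l q → Mirrored l q
  Pal⇒Mirrored {l} {q} P {i} {j} l≤i i≤q i+j≡l+q =
    subst₂ (λ a b → (S at a) ≈c (S at b)) (m+[n∸m]≡n l≤i) q∸k≡j
      (subst (λ t → (S at (l + t)) ≈c (S at (q ∸ t))) (toℕ-fromℕ< k<) (P (fromℕ< k<)))
    where
    k< : i ∸ l < suc q ∸ l
    k< = ∸-monoˡ-< (s≤s i≤q) l≤i
    k+j≡q : i ∸ l + j ≡ q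
    k+j≡q = begin
      i ∸ l + j   ≡⟨ +-∸-comm j l≤i ⟨
      i + j ∸ l   ≡⟨ cong (_∸ l) i+j≡l+q ⟩
      l + q ∸ l   ≡⟨ m+n∸m≡n l q ⟩
      q           ∎
      where open ≡-Reasoning
    q∸k≡j : q ∸ (i ∸ l) ≡ j
    q∸k≡j = trans (cong (_∸ (i ∸ l)) (sym k+j≡q)) (m+n∸m≡n (i ∸ l) j)

  Mirrored⇒Pal : ∀ {l q} → Mirrored l q → Pal S l q
  Mirrored⇒Pal {l} {q} M k = M (m≤m+n l (toℕ k)) l+k≤q l+k+[q∸k]≡l+q
    where
    l+k≤q : l + toℕ k ≤ q
    l+k≤q = s≤s⁻¹ (m<n∸o⇒o+m<n (suc q) l (toℕ<n k))
    l+k+[q∸k]≡l+q : l + toℕ k + (q ∸ toℕ k) ≡ l + q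
    l+k+[q∸k]≡l+q = trans (+-assoc l (toℕ k) _)
      (cong (l +_) (m+[n∸m]≡n (≤-trans (m≤n+m (toℕ k) l) l+k≤q)))

  Mirrored-point : ∀ l → Mirrored l l
  Mirrored-point l {i} {j} l≤i i≤l i+j≡l+l =
    subst₂ (λ a b → (S at a) ≈c (S at b)) (sym i≡l) (+-cancelˡ-≡ l l j l+l≡l+j) (≈c-refl _)
    where
    i≡l : i ≡ l
    i≡l = ≤-antisym i≤l l≤i
    l+l≡l+j : l + l ≡ l + j
    l+l≡l+j = trans (sym i+j≡l+l) (cong (_+ j) i≡l)

  Mirrored-shrink : ∀ {l q l′ q′} → Mirrored l q → l ≤ l′ → l′ + q′ ≡ l + q → Mirrored l′ q′
  Mirrored-shrink {l} {q} {l′} {q′} M l≤l′ sum≡ l′≤i i≤q′ i+j≡ =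
    M (≤-trans l≤l′ l′≤i) (≤-trans i≤q′ q′≤q) (trans i+j≡ sum≡)
    where
    q′≤q : q′ ≤ q
    q′≤q = +-cancelˡ-≤ l′ q′ q (≤-trans (≤-reflexive sum≡) (+-monoˡ-≤ q l≤l′))

  Mirrored-extend : ∀ {l q} → Mirrored (suc l) q → (S at l) ≈c (S at suc q) → Mirrored l (suc q)
  Mirrored-extend {l} {q} M lq {i} {j} l≤i i≤sq i+j≡ with m≤n⇒m<n∨m≡n l≤i | m≤n⇒m<n∨m≡n i≤sq
  ... | inj₂ refl | _ = subst (λ b → (S at i) ≈c (S at b)) (sym (+-cancelˡ-≡ i j (suc q) i+j≡)) lq
  ... | inj₁ _ | inj₂ refl = subst (λ b → (S at i) ≈c (S at b)) (sym j≡l) (≈c-sym lq)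
    where
    j≡l : j ≡ l
    j≡l = +-cancelˡ-≡ i j l (trans i+j≡ (+-comm l i))
  ... | inj₁ sl≤i | inj₁ i<sq = M sl≤i (s≤s⁻¹ i<sq) (trans i+j≡ (+-suc l q))

  centre-sum : ∀ {c r} → r ≤ c → c ∸ r + (c + r) ≡ c + c
  centre-sum {c} {r} r≤c = begin
    c ∸ r + (c + r)   ≡⟨ cong (c ∸ r +_) (+-comm c r) ⟩
    c ∸ r + (r + c)   ≡⟨ +-assoc (c ∸ r) r c ⟨
    c ∸ r + r + c     ≡⟨ cong (_+ c) (m∸n+n≡m r≤c) ⟩
    c + c             ∎
    where open ≡-Reasoning

  SubPal-zero : ∀ {c} → 1 ≤ c → c ≤ n → SubPal S c 0
  SubPal-zero {c} 1≤c c≤n =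
    1≤c , subst (_≤ n) (sym (+-identityʳ c)) c≤n ,
    subst (Pal S c) (sym (+-identityʳ c)) (Mirrored⇒Pal (Mirrored-point c))

  SubPal-≤ : ∀ {c r r′} → SubPal S c r → r′ ≤ r → SubPal S c r′
  SubPal-≤ {c} {r} {r′} (r<c , c+r≤n , P) r′≤r =
    r′<c , ≤-trans (+-monoʳ-≤ c r′≤r) c+r≤n ,
    Mirrored⇒Pal (Mirrored-shrink (Pal⇒Mirrored P) (∸-monoʳ-≤ c r′≤r)
      (trans (centre-sum (<⇒≤ r′<c)) (sym (centre-sum (<⇒≤ r<c)))))
    where
    r′<c : r′ < c
    r′<c = ≤-<-trans r′≤r r<c

  SubPal-suc : ∀ {c r} → SubPal S c r → suc r < c → c + suc r ≤ n →
               (S at (c ∸ suc r)) ≈c (S at (c + suc r)) → SubPal S c (suc r)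
  SubPal-suc {suc c} {r} (_ , _ , P) sr<sc sc+sr≤n match =
    sr<sc , sc+sr≤n ,
    subst (Pal S (c ∸ r)) (sym (+-suc (suc c) r))
      (Mirrored⇒Pal (Mirrored-extend M
        (subst (λ b → (S at (c ∸ r)) ≈c (S at b)) (+-suc (suc c) r) match)))
    where
    M : Mirrored (suc (c ∸ r)) (suc c + r)
    M = subst (λ a → Mirrored a (suc c + r)) (+-∸-assoc 1 (s≤s⁻¹ (<⇒≤ sr<sc))) (Pal⇒Mirrored P)

  SubPal-outer : ∀ {c r} → SubPal S c r → (S at (c ∸ r)) ≈c (S at (c + r))
  SubPal-outer {c} {r} (_ , _ , P) =
    Pal⇒Mirrored P ≤-refl (≤-trans (m∸n≤m c r) (m≤m+n c r)) refl

  PalPrefix⇒SubPal : ∀ {p c} → p ≤ n → PalPrefix S p c → SubPal S c (c ∸ 1)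
  PalPrefix⇒SubPal {p} {c} p≤n (1≤c , le , P) =
    ∸-monoʳ-< {c} {1} {0} (s≤s z≤n) 1≤c ,
    ≤-trans (≤-reflexive (sym (+-∸-assoc c 1≤c))) (≤-trans le p≤n) ,
    subst₂ (Pal S) (sym (m∸[m∸n]≡n 1≤c)) (+-∸-assoc c 1≤c) P

  PalSuffix⇒SubPal : ∀ {p c} → p ≤ n → PalSuffix S p c → SubPal S c (p ∸ c)
  PalSuffix⇒SubPal {p} {c} p≤n (p<c+c , c≤p , P) =
    subst (p ∸ c <_) (m+n∸m≡n c c) (∸-monoˡ-< p<c+c c≤p) ,
    subst (_≤ n) (sym (m+[n∸m]≡n c≤p)) p≤n ,
    subst₂ (Pal S) left≡ (sym (m+[n∸m]≡n c≤p)) P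
    where
    left≡ : c + c ∸ p ≡ c ∸ (p ∸ c)
    left≡ = trans (cong (c + c ∸_) (sym (m+[n∸m]≡n c≤p))) ([m+n]∸[m+o]≡n∸o c c (p ∸ c))

  SubPal-⊔ : ∀ {c a b} → SubPal S c a → SubPal S c b → SubPal S c (a ⊔ b)
  SubPal-⊔ {c} {a} {b} sa sb with ⊔-sel a b
  ... | inj₁ a⊔b≡a = subst (SubPal S c) (sym a⊔b≡a) sa
  ... | inj₂ a⊔b≡b = subst (SubPal S c) (sym a⊔b≡b) sb

  SubPal-bound-centre : ∀ {c r r′} → c ∸ 1 ≤ r → SubPal S c r′ → r′ ≤ r
  SubPal-bound-centre c∸1≤r (r′<c , _ , _) = ≤-trans (∸-monoˡ-≤ 1 r′<c) c∸1≤r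

  SubPal-bound-left : ∀ {c r r′} → c ∸ r ≤ 1 → SubPal S c r′ → r′ ≤ r
  SubPal-bound-left {c} {r} {r′} c∸r≤1 (r′<c , _ , _) = s≤s⁻¹ (begin
    suc r′         ≤⟨ r′<c ⟩
    c              ≤⟨ m≤n+m∸n c r ⟩
    r + (c ∸ r)    ≤⟨ +-monoʳ-≤ r c∸r≤1 ⟩
    r + 1          ≡⟨ +-comm r 1 ⟩
    suc r          ∎)
    where open ≤-Reasoning

  SubPal-bound-right : ∀ {c r r′} → n ≤ c + r → SubPal S c r′ → r′ ≤ r
  SubPal-bound-right {c} {r} {r′} n≤c+r (_ , c+r′≤n , _) = +-cancelˡ-≤ c r′ r (≤-trans c+r′≤n n≤c+r)

  SubPal-bound-mismatch : ∀ {c r r′} → ¬ ((S at (c ∸ suc r)) ≈c (S at (c + suc r))) →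
                          SubPal S c r′ → r′ ≤ r
  SubPal-bound-mismatch {r = r} {r′} mismatch sp with r′ ≤? r
  ... | yes r′≤r = r′≤r
  ... | no r′≰r  = contradiction (SubPal-outer (SubPal-≤ sp (≰⇒> r′≰r))) mismatch

  next-pair-≡ : ∀ c r → ((S at (c ∸ r ∸ 1)) ≈c (S at suc (c + r)))
                      ≡ ((S at (c ∸ suc r)) ≈c (S at (c + suc r)))
  next-pair-≡ c r = cong₂ (λ a b → (S at a) ≈c (S at b)) (m∸n∸1≡m∸suc[n] c r) (sym (+-suc c r))

  IsMaxRadius+0 : ∀ {c r} → SubPal S c r → (∀ {r′} → SubPal S c r′ → r′ ≤ r) →
                  IsMaxRadius S c (r + 0)
  IsMaxRadius+0 {c} {r} sp bound = subst (IsMaxRadius S c) (sym (+-identityʳ r)) (sp , λ _ → bound)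

  module _ (eq : DecidableEquality A) where

    phase1-step-SubPal : ∀ {p R c} → p ≤ n → SubPal S c (R c) → SubPal S c (phase1-step eq S p R c)
    phase1-step-SubPal {p} {R} {c} p≤n sR with PalPrefix-dec eq S p c ⊎-dec PalSuffix-dec eq S p c
    ... | no _           = sR
    ... | yes (inj₁ pre) = SubPal-⊔ sR (SubPal-≤ (PalPrefix⇒SubPal p≤n pre) (m⊓n≤m _ _))
    ... | yes (inj₂ suf) = SubPal-⊔ sR (SubPal-≤ (PalSuffix⇒SubPal p≤n suf) (m⊓n≤n _ _))

    phase1-upto-SubPal : ∀ u k {c} → 1 ≤ c → c ≤ n → SubPal S c (phase1-upto eq S u k c)
    phase1-upto-SubPal u zero    1≤c c≤n = SubPal-zero 1≤c c≤n
    phase1-upto-SubPal u (suc k) 1≤c c≤n =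
      phase1-step-SubPal (m⊓n≤n _ n) (phase1-upto-SubPal u k 1≤c c≤n)

    extendCount-maximal : ∀ f {c r} → c ∸ 1 ≤ f + r → SubPal S c r →
                          IsMaxRadius S c (r + extendCount eq S f (c ∸ r) (c + r))
    extendCount-maximal zero c∸1≤r sp = IsMaxRadius+0 sp (SubPal-bound-centre c∸1≤r)
    extendCount-maximal (suc f) {c} {r} fuel sp with 2 ≤? c ∸ r | suc (c + r) ≤? n
    ... | no c∸r≱2 | _ = IsMaxRadius+0 sp (SubPal-bound-left (s≤s⁻¹ (≰⇒> c∸r≱2)))
    ... | yes _ | no c+r≱n = IsMaxRadius+0 sp (SubPal-bound-right (s≤s⁻¹ (≰⇒> c+r≱n)))
    ... | yes 2≤c∸r | yes c+r<n with ≈c-dec eq (S at (c ∸ r ∸ 1)) (S at (suc (c + r)))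
    ...   | no mismatch =
      IsMaxRadius+0 sp (SubPal-bound-mismatch (mismatch ∘ subst id (sym (next-pair-≡ c r))))
    ...   | yes match = subst (IsMaxRadius S c) shift (extendCount-maximal f fuel′ sp′)
      where
      fuel′ : c ∸ 1 ≤ f + suc r
      fuel′ = subst (c ∸ 1 ≤_) (sym (+-suc f r)) fuel
      sp′ : SubPal S c (suc r)
      sp′ = SubPal-suc sp (subst (_< c) (+-comm r 1) (m<n∸o⇒o+m<n c r 2≤c∸r))
              (subst (_≤ n) (sym (+-suc c r)) c+r<n) (subst id (next-pair-≡ c r) match)
      shift : suc r + extendCount eq S f (c ∸ suc r) (c + suc r)
            ≡ r + suc (extendCount eq S f (c ∸ r ∸ 1) (suc (c + r)))
      shift = trans (sym (+-suc r _))
                (cong₂ (λ a b → r + suc (extendCount eq S f a b))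
                  (sym (m∸n∸1≡m∸suc[n] c r)) (+-suc c r))

mainTheorem2 : {A : Set} (eq : DecidableEquality A) (n : ℕ) (S : Vec (WChar A) n)
    (u : ℕ) (hu : 1 ≤ u) (c : ℕ) → 1 ≤ c → c ≤ n →
    IsMaxRadius S c (algorithm eq S u hu c)
mainTheorem2 eq n S u hu c 1≤c c≤n =
  extendCount-maximal S eq n (≤-trans (m∸n≤m c 1) (≤-trans c≤n (m≤m+n n _)))
    (phase1-upto-SubPal S eq u (ceilDiv n u hu) 1≤c c≤n)
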